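{- Let $D$ be a finite $m$-colored digraph without loops and without isolated vertices in which every chromatic class is transitive. Then $D$ has a kernel by properly colored paths.
   Context: An $m$-colored digraph has its arcs colored with $m$ colors. A chromatic class is the set of arcs of one color; it is transitive if the subdigraph formed by its arcs is a transitive digraph. A path (directed, with distinct vertices) is properly colored if consecutive arcs have different colors. A kernel by properly colored paths (PCP-kernel) is a set $N\subseteq V(D)$ such that there is no properly colored path between two distinct vertices of $N$, and for every $x\in V(D)\setminus N$ there is a properly colored path from $x$ to some vertex of $N$. -}

module Defs where

open import Data.Nat using (ℕ)
open import Data.Fin using (Fin)
open import Data.Fin.Subset using (Subset; _∈_; _∉_)
open import Data.Maybe using (Maybe; just; nothing)
open import Data.Product using (Σ; ∃; ∃-syntax; _×_; _,_)
open import Data.List using (List; []; _∷_)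
open import Data.List.Relation.Unary.Unique.Propositional using (Unique)
open import Relation.Binary.PropositionalEquality using (_≡_; _≢_)
open import Relation.Nullary using (¬_)

-- A finite m-colored digraph on vertex set Fin n.
-- colour u v ≡ just c  means there is an arc u → v, and it has colour c;
-- colour u v ≡ nothing means there is no arc u → v.
record ColoredDigraph (n m : ℕ) : Set where
  field
    colour : Fin n → Fin n → Maybe (Fin m)

open ColoredDigraph public

module _ {n m : ℕ} (D : ColoredDigraph n m) where

  Arc : Fin n → Fin n → Set
  Arc u v = ∃[ c ] colour D u v ≡ just c

  ArcOfColour : Fin m → Fin n → Fin n → Set
  ArcOfColour c u v = colour D u v ≡ just c

  Loopless : Set
  Loopless = ∀ v → colour D v v ≡ nothing

  Isolated : Fin n → Set
  Isolated v = ∀ u → colour D u v ≡ nothing × colour D v u ≡ nothing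

  NoIsolatedVertices : Set
  NoIsolatedVertices = ∀ v → ¬ Isolated v

  TransitiveClass : Fin m → Set
  TransitiveClass c = ∀ u v w → ArcOfColour c u v → ArcOfColour c v w →
                      u ≢ w → ArcOfColour c u w

  -- WalkFrom x ws y : consecutive vertices x ∷ ws are joined by arcs, ends in y;
  -- lastCol records the colour of the last arc used (nothing at the start),
  -- and consecutive arcs have distinct colours.
  data PCWalk : Maybe (Fin m) → Fin n → List (Fin n) → Fin n → Set where
    stop : ∀ {prev x} → PCWalk prev x [] x
    step : ∀ {prev x v vs y} (c : Fin m) →
           colour D x v ≡ just c →
           prev ≢ just c →
           PCWalk (just c) v vs y →
           PCWalk prev x (v ∷ vs) y

  PCPath : Fin n → Fin n → Set
  PCPath x y = Σ (List (Fin n)) λ vs → PCWalk nothing x vs y × Unique (x ∷ vs)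

  IsPCPKernel : Subset n → Set
  IsPCPKernel N =
    (∀ x y → x ∈ N → y ∈ N → x ≢ y → ¬ PCPath x y) ×
    (∀ x → x ∉ N → ∃[ y ] (y ∈ N × PCPath x y))

-- With transitive colour classes every properly coloured path can be extended backwards
-- along an arc: if the new arc repeats the colour of the first arc of the path,
-- transitivity of that colour class shortcuts the two arcs into one, and if the new
-- vertex already lies on the path, the path is cut there. Hence properly coloured
-- reachability is ordinary reachability, a preorder, and choosing one vertex in every
-- terminal strong component yields a kernel by properly coloured paths.
module Submission where

open import Defs
open import Data.Nat using (ℕ; zero; suc; _+_; _*_; _<_; s≤s)
import Data.Nat as ℕ
open import Data.Nat.Properties
  using (<⇒≤; ≰⇒>; +-comm; m≤m+n; +-monoʳ-<; +-mono-≤-<; *-monoˡ-≤; module ≤-Reasoning)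
open import Data.Nat.Induction using (<-wellFounded)
open import Data.Fin using (Fin; zero; suc; toℕ; _≤_)
open import Data.Fin.Properties
  using (_≟_; _≤?_; ≤-antisym; all?; any?; ¬∀⟶∃¬; injective⇒≤; toℕ<n)
open import Data.Fin.Subset using (Subset; _∈_; _∉_; _⊆_; _⊂_; ∣_∣)
open import Data.Fin.Subset.Properties using (p⊆q⇒∣p∣≤∣q∣; p⊂q⇒∣p∣<∣q∣)
open import Data.Vec using (tabulate)
open import Data.Vec.Properties using (lookup∘tabulate; lookup⇒[]=; []=⇒lookup)
open import Data.Maybe using (just; nothing)
open import Data.Maybe.Properties using (just-injective)
open import Data.Product using (∃; ∃-syntax; _×_; _,_; proj₂)
open import Data.Sum using (_⊎_; inj₁; inj₂)
open import Data.List using (List; []; _∷_; length; lookup)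
open import Data.List.Relation.Unary.Any using (here; there)
import Data.List.Relation.Unary.All as All
open import Data.List.Relation.Unary.All.Properties using (¬Any⇒All¬)
open import Data.List.Relation.Unary.AllPairs using ([]; _∷_)
open import Data.List.Relation.Unary.Unique.Propositional using (Unique)
open import Data.List.Membership.Propositional using () renaming (_∈_ to _∈ₗ_; _∉_ to _∉ₗ_)
open import Data.List.Membership.Propositional.Properties using (∈-lookup)
open import Function using (_∘_)
open import Function.Definitions using (Injective)
open import Induction.WellFounded using (Acc; acc)
open import Level using (Level)
open import Relation.Binary using (Rel; Reflexive; Transitive; Decidable)
open import Relation.Binary.PropositionalEquality using (_≡_; _≢_; refl; sym; trans; cong)
open import Relation.Nullary using (¬_; yes; no; does; contradiction)
open import Relation.Nullary.Decidable using (_×-dec_; _⊎-dec_; _→-dec_; dec-true)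
open import Relation.Unary using (Pred)
import Relation.Unary as U

private
  variable
    a ℓ : Level
    A : Set a
    n : ℕ

unique⇒lookup-injective : {xs : List A} → Unique xs → Injective _≡_ _≡_ (lookup xs)
unique⇒lookup-injective (x∉xs ∷ u) {zero}  {zero}  _  = refl
unique⇒lookup-injective (x∉xs ∷ u) {zero}  {suc j} eq = contradiction eq (All.lookup x∉xs (∈-lookup j))
unique⇒lookup-injective (x∉xs ∷ u) {suc i} {zero}  eq = contradiction (sym eq) (All.lookup x∉xs (∈-lookup i))
unique⇒lookup-injective (x∉xs ∷ u) {suc i} {suc j} eq = cong suc (unique⇒lookup-injective u eq)

unique⇒length≤ : {xs : List (Fin n)} → Unique xs → length xs ℕ.≤ n
unique⇒length≤ u = injective⇒≤ (unique⇒lookup-injective u)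

module _ {P : Pred (Fin n) ℓ} (P? : U.Decidable P) where

  subsetOf : Subset n
  subsetOf = tabulate (does ∘ P?)

  ∈-subsetOf⁺ : ∀ {y} → P y → y ∈ subsetOf
  ∈-subsetOf⁺ {y} py = lookup⇒[]= y subsetOf (trans (lookup∘tabulate _ y) (dec-true (P? y) py))

  ∈-subsetOf⁻ : ∀ {y} → y ∈ subsetOf → P y
  ∈-subsetOf⁻ {y} y∈ with P? y | trans (sym (lookup∘tabulate (does ∘ P?) y)) ([]=⇒lookup y∈)
  ... | yes py | _ = py
  ... | no _   | ()

module TerminalRepresentatives
  {_≲_ : Rel (Fin n) ℓ} (≲-refl : Reflexive _≲_) (≲-trans : Transitive _≲_) (_≲?_ : Decidable _≲_)
  where

  NoEscape : Fin n → Fin n → Set ℓ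
  NoEscape x y = x ≲ y → y ≲ x × x ≤ y

  noEscape? : ∀ x → U.Decidable (NoEscape x)
  noEscape? x y = x ≲? y →-dec (y ≲? x ×-dec x ≤? y)

  -- The least-indexed element of a maximal equivalence class of ≲.
  Representative : Pred (Fin n) ℓ
  Representative x = ∀ y → NoEscape x y

  representative? : U.Decidable Representative
  representative? x = all? (noEscape? x)

  representatives : Subset n
  representatives = subsetOf representative?

  representatives-incomparable : ∀ {x y} → x ∈ representatives → y ∈ representatives → x ≲ y → x ≡ y
  representatives-incomparable {x} {y} x∈ y∈ x≲y =
    let (y≲x , x≤y) = ∈-subsetOf⁻ representative? x∈ y x≲y
    in ≤-antisym x≤y (proj₂ (∈-subsetOf⁻ representative? y∈ x y≲x))

  upset : Fin n → Subset n
  upset x = subsetOf (x ≲?_)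

  upset-antitone : ∀ {x y} → x ≲ y → upset y ⊆ upset x
  upset-antitone x≲y z∈ = ∈-subsetOf⁺ (_ ≲?_) (≲-trans x≲y (∈-subsetOf⁻ (_ ≲?_) z∈))

  upset-strict : ∀ {x y} → x ≲ y → ¬ y ≲ x → upset y ⊂ upset x
  upset-strict {x} x≲y y≴x =
    upset-antitone x≲y , x , ∈-subsetOf⁺ (x ≲?_) ≲-refl , y≴x ∘ ∈-subsetOf⁻ (_ ≲?_)

  -- Lexicographic in (size of the upset, index).
  rank : Fin n → ℕ
  rank x = ∣ upset x ∣ * n + toℕ x

  rank-decreasing : ∀ {x y} → x ≲ y → ¬ (y ≲ x × x ≤ y) → rank y < rank x
  rank-decreasing {x} {y} x≲y ¬back with y ≲? x
  ... | yes y≲x = +-mono-≤-< (*-monoˡ-≤ n (p⊆q⇒∣p∣≤∣q∣ (upset-antitone x≲y))) (≰⇒> (¬back ∘ (y≲x ,_)))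
  ... | no y≴x = begin-strict
    ∣ upset y ∣ * n + toℕ y  <⟨ +-monoʳ-< (∣ upset y ∣ * n) (toℕ<n y) ⟩
    ∣ upset y ∣ * n + n      ≡⟨ +-comm (∣ upset y ∣ * n) n ⟩
    suc ∣ upset y ∣ * n      ≤⟨ *-monoˡ-≤ n (p⊂q⇒∣p∣<∣q∣ (upset-strict x≲y y≴x)) ⟩
    ∣ upset x ∣ * n          ≤⟨ m≤m+n (∣ upset x ∣ * n) (toℕ x) ⟩
    rank x                   ∎
    where open ≤-Reasoning

  ¬representative⇒escape : ∀ {x} → ¬ Representative x → ∃[ y ] x ≲ y × ¬ (y ≲ x × x ≤ y)
  ¬representative⇒escape {x} ¬rx with ¬∀⟶∃¬ n (NoEscape x) (noEscape? x) ¬rx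
  ... | y , escape with x ≲? y
  ...   | yes x≲y = y , x≲y , escape ∘ λ back _ → back
  ...   | no x≴y = contradiction (λ x≲y → contradiction x≲y x≴y) escape

  representative-above : ∀ x → ∃[ y ] y ∈ representatives × x ≲ y
  representative-above x = climb x (<-wellFounded (rank x))
    where
    climb : ∀ x → Acc _<_ (rank x) → ∃[ y ] y ∈ representatives × x ≲ y
    climb x (acc rs) with representative? x
    ... | yes rx = x , ∈-subsetOf⁺ representative? rx , ≲-refl
    ... | no ¬rx =
      let (y , x≲y , ¬back) = ¬representative⇒escape ¬rx
          (z , z∈ , y≲z) = climb y (rs (rank-decreasing x≲y ¬back))
      in z , z∈ , ≲-trans x≲y y≲z

module _ {m} (D : ColoredDigraph n m) where

  open import Data.List.Membership.DecPropositional (_≟_ {n}) using () renaming (_∈?_ to _∈ₗ?_)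

  pcPath-refl : ∀ x → PCPath D x x
  pcPath-refl x = [] , stop , All.[] ∷ []

  pcWalk-forgetColour : ∀ {c x vs y} → PCWalk D c x vs y → PCWalk D nothing x vs y
  pcWalk-forgetColour stop = stop
  pcWalk-forgetColour (step c e _ w) = step c e (λ ()) w

  pcPath-suffix : ∀ {c v vs z x} → PCWalk D c v vs z → Unique (v ∷ vs) → x ∈ₗ vs → PCPath D x z
  pcPath-suffix (step _ _ _ w) (_ ∷ u) (here refl) = _ , pcWalk-forgetColour w , u
  pcPath-suffix (step _ _ _ w) (_ ∷ u) (there x∈) = pcPath-suffix w u x∈

  arc-irreflexive : Loopless D → ∀ {x v c} → colour D x v ≡ just c → x ≢ v
  arc-irreflexive loopless {x} e refl = contradiction (trans (sym e) (loopless x)) λ ()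

  -- Bounded, so that it is decidable; pcPath⇒reachableWithin shows the bound n suffices.
  ReachableWithin : ℕ → Fin n → Fin n → Set
  ReachableWithin zero x y = x ≡ y
  ReachableWithin (suc k) x y = x ≡ y ⊎ ∃[ v ] Arc D x v × ReachableWithin k v y

  arc? : Decidable (Arc D)
  arc? x v with colour D x v
  ... | just c = yes (c , refl)
  ... | nothing = no λ ()

  reachableWithin? : ∀ k → Decidable (ReachableWithin k)
  reachableWithin? zero x y = x ≟ y
  reachableWithin? (suc k) x y = x ≟ y ⊎-dec any? λ v → arc? x v ×-dec reachableWithin? k v y

  reachableWithin-refl : ∀ k {x} → ReachableWithin k x x
  reachableWithin-refl zero = refl
  reachableWithin-refl (suc k) = inj₁ refl

  pcWalk⇒reachableWithin : ∀ {c x vs y} k → PCWalk D c x vs y → length vs ℕ.≤ k → ReachableWithin k x y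
  pcWalk⇒reachableWithin k stop _ = reachableWithin-refl k
  pcWalk⇒reachableWithin (suc k) (step c e _ w) (s≤s ≤k) = inj₂ (_ , (c , e) , pcWalk⇒reachableWithin k w ≤k)

  pcPath⇒reachableWithin : ∀ {x y} → PCPath D x y → ReachableWithin n x y
  pcPath⇒reachableWithin (vs , w , u) = pcWalk⇒reachableWithin n w (<⇒≤ (unique⇒length≤ u))

  module _ (transitive : ∀ c → TransitiveClass D c) where

    arc-pcPath-fresh : ∀ {x v vs z c} → colour D x v ≡ just c → PCWalk D nothing v vs z →
                       Unique (v ∷ vs) → x ∉ₗ v ∷ vs → PCPath D x z
    arc-pcPath-fresh {v = v} {c = c} e stop u x∉ = v ∷ [] , step c e (λ ()) stop , ¬Any⇒All¬ _ x∉ ∷ u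
    arc-pcPath-fresh {v = v} {c = c} e (step {v = q} {vs = vs} c₁ e₁ _ w) u@(_ ∷ u′) x∉ with c ≟ c₁
    ... | no c≢c₁ = v ∷ q ∷ vs , step c e (λ ()) (step c₁ e₁ (c≢c₁ ∘ just-injective) w) , ¬Any⇒All¬ _ x∉ ∷ u
    ... | yes refl =
      q ∷ vs , step c (transitive c _ v q e e₁ (x∉ ∘ there ∘ here)) (λ ()) w , ¬Any⇒All¬ _ (x∉ ∘ there) ∷ u′

    arc-pcPath : Loopless D → ∀ {x v z} → Arc D x v → PCPath D v z → PCPath D x z
    arc-pcPath loopless {x} {v} (c , e) (vs , w , u) with x ∈ₗ? v ∷ vs
    ... | yes (here x≡v) = contradiction x≡v (arc-irreflexive loopless e)
    ... | yes (there x∈) = pcPath-suffix w u x∈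
    ... | no x∉ = arc-pcPath-fresh e w u x∉

    module _ (loopless : Loopless D) where

      reachableWithin-pcPath : ∀ k {x y z} → ReachableWithin k x y → PCPath D y z → PCPath D x z
      reachableWithin-pcPath zero refl p = p
      reachableWithin-pcPath (suc k) (inj₁ refl) p = p
      reachableWithin-pcPath (suc k) (inj₂ (v , a , r)) p =
        arc-pcPath loopless a (reachableWithin-pcPath k r p)

      reachable-trans : Transitive (ReachableWithin n)
      reachable-trans r r′ =
        pcPath⇒reachableWithin (reachableWithin-pcPath n r (reachableWithin-pcPath n r′ (pcPath-refl _)))

      open TerminalRepresentatives (reachableWithin-refl n) reachable-trans (reachableWithin? n)

      pcpKernel : ∃ λ (N : Subset n) → IsPCPKernel D N
      pcpKernel = representatives , independent , absorbing
        where
        independent : ∀ x y → x ∈ representatives → y ∈ representatives → x ≢ y → ¬ PCPath D x y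
        independent x y x∈ y∈ x≢y p = x≢y (representatives-incomparable x∈ y∈ (pcPath⇒reachableWithin p))

        absorbing : ∀ x → x ∉ representatives → ∃[ y ] y ∈ representatives × PCPath D x y
        absorbing x _ =
          let (y , y∈ , r) = representative-above x
          in y , y∈ , reachableWithin-pcPath n r (pcPath-refl y)

mainTheorem13 : (n m : ℕ) (D : ColoredDigraph n m) →
    Loopless D → NoIsolatedVertices D → (∀ c → TransitiveClass D c) →
    ∃ λ (N : Subset n) → IsPCPKernel D N
mainTheorem13 n m D loopless _ transitive = pcpKernel D transitive loopless
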